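{- Let $n\geq 1$ and $k\geq 2$ be integers. Then \[C_k(n)\leq \sum_{t=1}^{\lfloor n/2\rfloor}k^tA_k(n-2t,0^t)+nk^{\lceil n/2\rceil}.\]
   Context: Words are over $\Sigma_k=\{0,1,\ldots,k-1\}$. A word $u$ is a border of $w$ if it is a non-empty proper prefix and proper suffix of $w$. A word $w$ is closed if $|w|\leq 1$ or $w$ has a border occurring exactly twice in $w$ as a factor. $C_k(n)$ is the number of length-$n$ closed words over $\Sigma_k$. $A_k(m,v)$ is the number of length-$m$ words over $\Sigma_k$ not containing $v$ as a factor; $0^t$ is the word of $t$ zeros. -}

module Defs where

open import Data.Nat using (ℕ; zero; suc; _+_; _*_; _∸_; _^_; _≤_; _<_; _≤?_; _<?_)
import Data.Nat.Properties as ℕP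
open import Data.Fin using (Fin; toℕ; fromℕ<)
import Data.Fin.Properties as FinP
open import Data.List using (List; []; _∷_; length; take; drop; map; concatMap; allFin; filter)
import Data.List.Properties as ListP
open import Data.Product using (Σ; _×_; _,_)
open import Data.Sum using (_⊎_)
open import Relation.Nullary using (Dec; ¬_)
open import Relation.Nullary.Decidable using (_×-dec_; _⊎-dec_; ¬?)
open import Relation.Binary.PropositionalEquality using (_≡_)

Word : ℕ → Set
Word k = List (Fin k)

_≟w_ : ∀ {k} (u v : Word k) → Dec (u ≡ v)
_≟w_ = ListP.≡-dec FinP._≟_

OccursAt : ∀ {k} → Word k → (w : Word k) → Fin (suc (length w)) → Set
OccursAt v w i = take (length v) (drop (toℕ i) w) ≡ v

occursAt? : ∀ {k} (v w : Word k) (i : Fin (suc (length w))) → Dec (OccursAt v w i)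
occursAt? v w i = take (length v) (drop (toℕ i) w) ≟w v

count : ∀ {a p} {X : Set a} {P : X → Set p} → ((x : X) → Dec (P x)) → List X → ℕ
count P? xs = length (filter P? xs)

-- number of occurrences of v as a factor of w (counted by starting positions)
occ : ∀ {k} → Word k → Word k → ℕ
occ v w = count (occursAt? v w) (allFin (suc (length w)))

Factor : ∀ {k} → Word k → Word k → Set
Factor v w = Σ (Fin (suc (length w))) (OccursAt v w)

factor? : ∀ {k} (v w : Word k) → Dec (Factor v w)
factor? v w = FinP.any? (occursAt? v w)

-- the border of length j of w: the prefix of length j, required to be
-- non-empty (0 < j), proper (j < |w|) and equal to the suffix of length j
IsBorderLen : ∀ {k} → (w : Word k) → Fin (length w) → Set
IsBorderLen w j = (0 < toℕ j) × (take (toℕ j) w ≡ drop (length w ∸ toℕ j) w)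

Closed : ∀ {k} → Word k → Set
Closed w = (length w ≤ 1)
         ⊎ Σ (Fin (length w)) (λ j → IsBorderLen w j × (occ (take (toℕ j) w) w ≡ 2))

closed? : ∀ {k} (w : Word k) → Dec (Closed w)
closed? w = (length w ≤? 1) ⊎-dec FinP.any? (λ j →
  ((0 <? toℕ j) ×-dec (take (toℕ j) w ≟w drop (length w ∸ toℕ j) w))
  ×-dec (occ (take (toℕ j) w) w ℕP.≟ 2))

words : (k n : ℕ) → List (Word k)
words k zero = [] ∷ []
words k (suc n) = concatMap (λ a → map (a ∷_) (words k n)) (allFin k)

C : ℕ → ℕ → ℕ
C k n = count closed? (words k n)

A : (k : ℕ) → ℕ → Word k → ℕ
A k m v = count (λ w → ¬? (factor? v w)) (words k m)

letter0 : ∀ {k} → 1 ≤ k → Fin k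
letter0 k≥1 = fromℕ< k≥1

zeros : ∀ {k} → Fin k → ℕ → Word k
zeros z zero = []
zeros z (suc t) = z ∷ zeros z t

sumFrom1 : ℕ → (ℕ → ℕ) → ℕ
sumFrom1 zero f = 0
sumFrom1 (suc m) f = sumFrom1 m f + f (suc m)

-- A closed word w of length n ≥ 2 has a border u of some length t occurring exactly twice in w.
-- If 2t ≥ n, then w has period p = n − t ≤ ⌊n/2⌋, so it is determined by its first p letters;
-- this leaves at most ⌊n/2⌋ k^⌈n/2⌉ words. If 2t < n, then w = u x u where u is not a factor of x
-- (that would be a third occurrence); this leaves at most k^t A_k(n − 2t, u) words. Finally
-- A_k(m, u) ≤ A_k(m, 0^t) for every u of length t: a naive scan for u that restarts after every
-- mismatch accepts all words avoiding u, the number of words it accepts depends only on t, and for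
-- u = 0^t it accepts exactly the words avoiding 0^t.

module Submission where

open import Defs
open import Data.Nat
  using (ℕ; zero; suc; _+_; _*_; _∸_; _^_; _≤_; _<_; _≤?_; z≤n; s≤s; ⌊_/2⌋; ⌈_/2⌉; pred; >-nonZero)
open import Data.Nat.Properties
open import Data.Nat.Induction using (<-rec)
open import Data.Nat.ListAction using (sum)
open import Data.Nat.ListAction.Properties using (sum-++)
open import Data.Bool using (Bool; true; false; _∧_; _∨_; not; if_then_else_)
open import Data.Bool.Properties using (∨-zeroʳ; ∧-zeroʳ; ∧-identityʳ)
open import Data.Fin using (Fin; toℕ; fromℕ<) renaming (zero to fzero; suc to fsuc)
import Data.Fin.Properties as Fin
open import Data.List using (List; []; _∷_; length; take; drop; map; concatMap; allFin; _++_)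
open import Data.List.Properties
  using ( map-++; map-∘; map-cong; map-tabulate; length-tabulate; length-++; length-++-≤ˡ; length-take
        ; ++-assoc; ++-identityʳ; take++drop≡id; drop-drop)
import Data.List.Relation.Unary.All as All
open All using (All; []; _∷_)
open import Data.List.Relation.Unary.All.Properties using (map⁺; concat⁺)
open import Data.Product using (∃; ∃₂; _×_; _,_)
open import Data.Sum using (_⊎_; inj₁; inj₂)
open import Data.Empty using (⊥-elim)
open import Function using (_∘_; id)
open import Relation.Nullary using (Dec; ¬_; yes; no; does)
open import Relation.Nullary.Decidable using (dec-true; dec-false; ¬?)
open import Relation.Binary.PropositionalEquality
open import Algebra.Properties.CommutativeSemigroup +-commutativeSemigroup using (interchange; x∙yz≈y∙xz)

private variable
  k : ℕ
  X Y : Set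

2*m≡m+m : ∀ m → 2 * m ≡ m + m
2*m≡m+m m = cong (m +_) (+-identityʳ m)

m+m≤n⇒m≤⌊n/2⌋ : ∀ {m n} → m + m ≤ n → m ≤ ⌊ n /2⌋
m+m≤n⇒m≤⌊n/2⌋ {m} m+m≤n = subst (_≤ _) (sym (n≡⌊n+n/2⌋ m)) (⌊n/2⌋-mono m+m≤n)

m≤⌊n/2⌋⇒2*m≤n : ∀ {m} n → m ≤ ⌊ n /2⌋ → 2 * m ≤ n
m≤⌊n/2⌋⇒2*m≤n {m} n m≤⌊n/2⌋ = begin
  2 * m              ≡⟨ 2*m≡m+m m ⟩
  m + m              ≤⟨ +-mono-≤ m≤⌊n/2⌋ (≤-trans m≤⌊n/2⌋ (⌊n/2⌋≤⌈n/2⌉ n)) ⟩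
  ⌊ n /2⌋ + ⌈ n /2⌉  ≡⟨ ⌊n/2⌋+⌈n/2⌉≡n n ⟩
  n                  ∎
  where open ≤-Reasoning

n≡t+[[n∸2t]+t] : ∀ {n} t → 2 * t ≤ n → n ≡ t + ((n ∸ 2 * t) + t)
n≡t+[[n∸2t]+t] {n} t 2t≤n = begin
  n                      ≡⟨ m∸n+n≡m 2t≤n ⟨
  (n ∸ 2 * t) + 2 * t    ≡⟨ cong ((n ∸ 2 * t) +_) (2*m≡m+m t) ⟩
  (n ∸ 2 * t) + (t + t)  ≡⟨ +-assoc (n ∸ 2 * t) t t ⟨
  ((n ∸ 2 * t) + t) + t  ≡⟨ +-comm _ t ⟩
  t + ((n ∸ 2 * t) + t)  ∎
  where open ≡-Reasoning

n∸t≡t+[n∸2t] : ∀ {n} t → 2 * t ≤ n → n ∸ t ≡ t + (n ∸ 2 * t)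
n∸t≡t+[n∸2t] t 2t≤n =
  trans (cong (_∸ t) (trans (n≡t+[[n∸2t]+t] t 2t≤n) (sym (+-assoc t _ t)))) (m+n∸n≡m _ t)

-- Counting with Boolean predicates

does≡true⇒ : {P : Set} (P? : Dec P) → does P? ≡ true → P
does≡true⇒ (yes p) _ = p

iverson : Bool → ℕ
iverson true = 1
iverson false = 0

countᵇ : (X → Bool) → List X → ℕ
countᵇ f xs = sum (map (iverson ∘ f) xs)

count≡countᵇ : {P : X → Set} (P? : ∀ x → Dec (P x)) (xs : List X) → count P? xs ≡ countᵇ (does ∘ P?) xs
count≡countᵇ P? [] = refl
count≡countᵇ P? (x ∷ xs) with does (P? x)
... | true = cong suc (count≡countᵇ P? xs)
... | false = count≡countᵇ P? xs

countᵇ-cong : {f g : X → Bool} → f ≗ g → (xs : List X) → countᵇ f xs ≡ countᵇ g xs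
countᵇ-cong f≗g xs = cong sum (map-cong (cong iverson ∘ f≗g) xs)

countᵇ-never : {f : X → Bool} (xs : List X) → (∀ x → f x ≡ false) → countᵇ f xs ≡ 0
countᵇ-never [] never = refl
countᵇ-never {f = f} (x ∷ xs) never rewrite never x = countᵇ-never xs never

countᵇ-mono : {Q : X → Set} {f g : X → Bool} {xs : List X} → All Q xs →
              (∀ x → Q x → f x ≡ true → g x ≡ true) → countᵇ f xs ≤ countᵇ g xs
countᵇ-mono [] f⇒g = z≤n
countᵇ-mono {f = f} {g} {x ∷ xs} (qx ∷ qxs) f⇒g with f x in fx
... | false = ≤-trans (countᵇ-mono qxs f⇒g) (m≤n+m _ (iverson (g x)))
... | true rewrite f⇒g x qx fx = s≤s (countᵇ-mono qxs f⇒g)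

length≡countᵇ-true : (xs : List X) → length xs ≡ countᵇ (λ _ → true) xs
length≡countᵇ-true [] = refl
length≡countᵇ-true (x ∷ xs) = cong suc (length≡countᵇ-true xs)

countᵇ≤length : (f : X → Bool) (xs : List X) → countᵇ f xs ≤ length xs
countᵇ≤length f [] = z≤n
countᵇ≤length f (x ∷ xs) = +-mono-≤ (iverson≤1 (f x)) (countᵇ≤length f xs)
  where
  iverson≤1 : ∀ b → iverson b ≤ 1
  iverson≤1 true = ≤-refl
  iverson≤1 false = z≤n

countᵇ-∨ : (f g : X → Bool) (xs : List X) → countᵇ (λ x → f x ∨ g x) xs ≤ countᵇ f xs + countᵇ g xs
countᵇ-∨ f g [] = z≤n
countᵇ-∨ f g (x ∷ xs) = begin
    iverson (f x ∨ g x) + countᵇ (λ x → f x ∨ g x) xs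
  ≤⟨ +-mono-≤ (iverson-∨ (f x) (g x)) (countᵇ-∨ f g xs) ⟩
    (iverson (f x) + iverson (g x)) + (countᵇ f xs + countᵇ g xs)
  ≡⟨ interchange (iverson (f x)) (iverson (g x)) (countᵇ f xs) (countᵇ g xs) ⟩
    (iverson (f x) + countᵇ f xs) + (iverson (g x) + countᵇ g xs)
  ∎
  where
  open ≤-Reasoning
  iverson-∨ : ∀ a b → iverson (a ∨ b) ≤ iverson a + iverson b
  iverson-∨ true b = s≤s z≤n
  iverson-∨ false b = ≤-refl

sum-concatMap : (g : X → ℕ) (h : Y → List X) (ys : List Y) →
                sum (map g (concatMap h ys)) ≡ sum (map (sum ∘ map g ∘ h) ys)
sum-concatMap g h [] = refl
sum-concatMap g h (y ∷ ys) = begin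
    sum (map g (h y ++ concatMap h ys))
  ≡⟨ cong sum (map-++ g (h y) (concatMap h ys)) ⟩
    sum (map g (h y) ++ map g (concatMap h ys))
  ≡⟨ sum-++ (map g (h y)) _ ⟩
    sum (map g (h y)) + sum (map g (concatMap h ys))
  ≡⟨ cong (sum (map g (h y)) +_) (sum-concatMap g h ys) ⟩
    sum (map g (h y)) + sum (map (sum ∘ map g ∘ h) ys)
  ∎
  where open ≡-Reasoning

sum-map-∘ : (g : X → ℕ) (h : Y → X) (ys : List Y) → sum (map g (map h ys)) ≡ sum (map (g ∘ h) ys)
sum-map-∘ g h ys = cong sum (sym (map-∘ ys))

sum-cong : {g h : X → ℕ} → g ≗ h → (xs : List X) → sum (map g xs) ≡ sum (map h xs)
sum-cong g≗h xs = cong sum (map-cong g≗h xs)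

sum-mono : {Q : X → Set} {g h : X → ℕ} {xs : List X} → All Q xs →
           (∀ x → Q x → g x ≤ h x) → sum (map g xs) ≤ sum (map h xs)
sum-mono [] g≤h = z≤n
sum-mono {xs = x ∷ xs} (qx ∷ qxs) g≤h = +-mono-≤ (g≤h x qx) (sum-mono qxs g≤h)

sum-const : {g : X → ℕ} {c : ℕ} (xs : List X) → (∀ x → g x ≡ c) → sum (map g xs) ≡ length xs * c
sum-const [] g≡c = refl
sum-const (x ∷ xs) g≡c = cong₂ _+_ (g≡c x) (sum-const xs g≡c)

sum≤length* : {Q : X → Set} {g : X → ℕ} {c : ℕ} {xs : List X} → All Q xs →
              (∀ x → Q x → g x ≤ c) → sum (map g xs) ≤ length xs * c
sum≤length* {c = c} {xs} qxs g≤c = ≤-trans (sum-mono qxs g≤c) (≤-reflexive (sum-const xs (λ _ → refl)))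

length-allFin : ∀ m → length (allFin m) ≡ m
length-allFin m = length-tabulate id

sum-allFin-suc : ∀ {m} (g : Fin (suc m) → ℕ) →
                 sum (map g (allFin (suc m))) ≡ g fzero + sum (map (g ∘ fsuc) (allFin m))
sum-allFin-suc g = cong (g fzero +_) (cong sum (trans (map-tabulate fsuc g) (sym (map-tabulate id (g ∘ fsuc)))))

sum-allFin-except : ∀ {m} (d : Fin m) (g : Fin m → ℕ) {a b : ℕ} → g d ≡ a → (∀ i → i ≢ d → g i ≡ b) →
                    sum (map g (allFin m)) ≡ a + pred m * b
sum-allFin-except {suc m} fzero g {a} {b} gd≡a g≡b = begin
    sum (map g (allFin (suc m)))
  ≡⟨ sum-allFin-suc g ⟩
    g fzero + sum (map (g ∘ fsuc) (allFin m))
  ≡⟨ cong₂ _+_ gd≡a (sum-const (allFin m) (λ i → g≡b (fsuc i) λ ())) ⟩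
    a + length (allFin m) * b
  ≡⟨ cong (λ l → a + l * b) (length-allFin m) ⟩
    a + m * b
  ∎
  where open ≡-Reasoning
sum-allFin-except {suc (suc m)} (fsuc d) g {a} {b} gd≡a g≡b = begin
    sum (map g (allFin (suc (suc m))))
  ≡⟨ sum-allFin-suc g ⟩
    g fzero + sum (map (g ∘ fsuc) (allFin (suc m)))
  ≡⟨ cong₂ _+_ (g≡b fzero λ ())
              (sum-allFin-except d (g ∘ fsuc) gd≡a (λ i i≢d → g≡b (fsuc i) (i≢d ∘ Fin.suc-injective))) ⟩
    b + (a + m * b)
  ≡⟨ x∙yz≈y∙xz b a (m * b) ⟩
    a + (b + m * b)
  ∎
  where open ≡-Reasoning

countᵇ-allFin-suc : ∀ {m} (f : Fin (suc m) → Bool) →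
                    countᵇ f (allFin (suc m)) ≡ iverson (f fzero) + countᵇ (f ∘ fsuc) (allFin m)
countᵇ-allFin-suc f = sum-allFin-suc (iverson ∘ f)

1≤countᵇ-allFin : ∀ {m} (f : Fin m → Bool) {i : Fin m} → f i ≡ true → 1 ≤ countᵇ f (allFin m)
1≤countᵇ-allFin {suc m} f {fzero} fi rewrite countᵇ-allFin-suc f | fi = s≤s z≤n
1≤countᵇ-allFin {suc m} f {fsuc i} fi rewrite countᵇ-allFin-suc f =
  ≤-trans (1≤countᵇ-allFin (f ∘ fsuc) fi) (m≤n+m _ (iverson (f fzero)))

2≤countᵇ-allFin : ∀ {m} (f : Fin m → Bool) {i j : Fin m} → toℕ i < toℕ j →
                  f i ≡ true → f j ≡ true → 2 ≤ countᵇ f (allFin m)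
2≤countᵇ-allFin {suc m} f {fzero} {fsuc j} i<j fi fj rewrite countᵇ-allFin-suc f | fi =
  s≤s (1≤countᵇ-allFin (f ∘ fsuc) fj)
2≤countᵇ-allFin {suc m} f {fsuc i} {fsuc j} (s≤s i<j) fi fj rewrite countᵇ-allFin-suc f =
  ≤-trans (2≤countᵇ-allFin (f ∘ fsuc) i<j fi fj) (m≤n+m _ (iverson (f fzero)))

3≤countᵇ-allFin : ∀ {m} (f : Fin m → Bool) {i j l : Fin m} → toℕ i < toℕ j → toℕ j < toℕ l →
                  f i ≡ true → f j ≡ true → f l ≡ true → 3 ≤ countᵇ f (allFin m)
3≤countᵇ-allFin {suc m} f {fzero} {fsuc j} {fsuc l} i<j (s≤s j<l) fi fj fl rewrite countᵇ-allFin-suc f | fi =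
  s≤s (2≤countᵇ-allFin (f ∘ fsuc) j<l fj fl)
3≤countᵇ-allFin {suc m} f {fsuc i} {fsuc j} {fsuc l} (s≤s i<j) (s≤s j<l) fi fj fl rewrite countᵇ-allFin-suc f =
  ≤-trans (3≤countᵇ-allFin (f ∘ fsuc) i<j j<l fi fj fl) (m≤n+m _ (iverson (f fzero)))

anyFrom1 : ℕ → (ℕ → Bool) → Bool
anyFrom1 zero f = false
anyFrom1 (suc m) f = anyFrom1 m f ∨ f (suc m)

anyFrom1-intro : ∀ m (f : ℕ → Bool) {t} → 0 < t → t ≤ m → f t ≡ true → anyFrom1 m f ≡ true
anyFrom1-intro zero f (s≤s _) () _
anyFrom1-intro (suc m) f {t} 0<t t≤1+m ft with m≤n⇒m<n∨m≡n t≤1+m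
... | inj₂ refl rewrite ft = ∨-zeroʳ (anyFrom1 m f)
... | inj₁ t<1+m rewrite anyFrom1-intro m f 0<t (≤-pred t<1+m) ft = refl

countᵇ-anyFrom1 : ∀ m (F : ℕ → X → Bool) (xs : List X) →
                  countᵇ (λ x → anyFrom1 m (λ t → F t x)) xs ≤ sumFrom1 m (λ t → countᵇ (F t) xs)
countᵇ-anyFrom1 zero F xs = ≤-reflexive (countᵇ-never xs (λ _ → refl))
countᵇ-anyFrom1 (suc m) F xs =
  ≤-trans (countᵇ-∨ (λ x → anyFrom1 m (λ t → F t x)) (F (suc m)) xs) (+-monoˡ-≤ _ (countᵇ-anyFrom1 m F xs))

sumFrom1-mono : ∀ m {f g : ℕ → ℕ} → (∀ t → 0 < t → t ≤ m → f t ≤ g t) → sumFrom1 m f ≤ sumFrom1 m g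
sumFrom1-mono zero f≤g = z≤n
sumFrom1-mono (suc m) f≤g =
  +-mono-≤ (sumFrom1-mono m (λ t 0<t t≤m → f≤g t 0<t (m≤n⇒m≤1+n t≤m))) (f≤g (suc m) (s≤s z≤n) ≤-refl)

sumFrom1≤* : ∀ m {f : ℕ → ℕ} {b : ℕ} → (∀ t → 0 < t → t ≤ m → f t ≤ b) → sumFrom1 m f ≤ m * b
sumFrom1≤* zero f≤b = z≤n
sumFrom1≤* (suc m) {b = b} f≤b = ≤-trans
  (+-mono-≤ (sumFrom1≤* m (λ t 0<t t≤m → f≤b t 0<t (m≤n⇒m≤1+n t≤m))) (f≤b (suc m) (s≤s z≤n) ≤-refl))
  (≤-reflexive (+-comm (m * b) b))

-- Words of a given length

countWords : ℕ → (Word k → Bool) → ℕ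
countWords {k} n f = countᵇ f (words k n)

words-length : ∀ n → All (λ w → length w ≡ n) (words k n)
words-length zero = refl ∷ []
words-length {k} (suc n) =
  concat⁺ (map⁺ (All.universal (λ a → map⁺ (All.map (cong suc) (words-length n))) (allFin k)))

countWords-suc : ∀ n (f : Word k → Bool) →
                 countWords (suc n) f ≡ sum (map (λ a → countWords n (f ∘ (a ∷_))) (allFin k))
countWords-suc {k} n f = trans (sum-concatMap (iverson ∘ f) _ (allFin k))
  (sum-cong (λ a → sum-map-∘ (iverson ∘ f) (a ∷_) (words k n)) (allFin k))

length-words : ∀ n → length (words k n) ≡ k ^ n
length-words zero = refl
length-words {k} (suc n) = begin
    length (words k (suc n))
  ≡⟨ length≡countᵇ-true (words k (suc n)) ⟩
    countWords {k} (suc n) (λ _ → true)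
  ≡⟨ countWords-suc {k} n (λ _ → true) ⟩
    sum (map (λ _ → countWords {k} n (λ _ → true)) (allFin k))
  ≡⟨ sum-const (allFin k) (λ _ → trans (sym (length≡countᵇ-true (words k n))) (length-words n)) ⟩
    length (allFin k) * k ^ n
  ≡⟨ cong (_* k ^ n) (length-allFin k) ⟩
    k * k ^ n
  ∎
  where open ≡-Reasoning

countWords-++ : ∀ a b (f : Word k → Bool) →
                countWords (a + b) f ≡ sum (map (λ u → countWords b (f ∘ (u ++_))) (words k a))
countWords-++ zero b f = sym (+-identityʳ _)
countWords-++ {k} (suc a) b f = begin
    countWords (suc (a + b)) f
  ≡⟨ countWords-suc (a + b) f ⟩
    sum (map (λ c → countWords (a + b) (f ∘ (c ∷_))) (allFin k))
  ≡⟨ sum-cong (λ c → countWords-++ a b (f ∘ (c ∷_))) (allFin k) ⟩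
    sum (map (λ c → sum (map (g ∘ (c ∷_)) (words k a))) (allFin k))
  ≡⟨ sum-cong (λ c → sym (sum-map-∘ g (c ∷_) (words k a))) (allFin k) ⟩
    sum (map (sum ∘ map g ∘ (λ c → map (c ∷_) (words k a))) (allFin k))
  ≡⟨ sym (sum-concatMap g _ (allFin k)) ⟩
    sum (map g (words k (suc a)))
  ∎
  where
  open ≡-Reasoning
  g : Word k → ℕ
  g u = countWords b (f ∘ (u ++_))

countWords-≟≤1 : ∀ n (c : Word k) → countWords n (λ v → does (v ≟w c)) ≤ 1
countWords-≟≤1 zero [] = ≤-refl
countWords-≟≤1 zero (_ ∷ _) = z≤n
countWords-≟≤1 {k} (suc n) [] = begin
    countWords (suc n) (λ (v : Word k) → does (v ≟w []))
  ≡⟨ countWords-suc n (λ (v : Word k) → does (v ≟w [])) ⟩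
    sum (map (λ _ → countWords {k} n (λ _ → false)) (allFin k))
  ≡⟨ sum-const (allFin k) (λ _ → countᵇ-never (words k n) (λ _ → refl)) ⟩
    length (allFin k) * 0
  ≡⟨ *-zeroʳ (length (allFin k)) ⟩
    0
  <⟨ s≤s z≤n ⟩
    1
  ∎
  where open ≤-Reasoning
countWords-≟≤1 {k} (suc n) (d ∷ c) = begin
    countWords (suc n) (λ v → does (v ≟w (d ∷ c)))
  ≡⟨ countWords-suc n (λ v → does (v ≟w (d ∷ c))) ⟩
    sum (map (λ a → countWords n (λ v → does (a Fin.≟ d) ∧ does (v ≟w c))) (allFin k))
  ≡⟨ sum-allFin-except d _
       (countᵇ-cong (λ v → cong (_∧ does (v ≟w c)) (dec-true (d Fin.≟ d) refl)) (words k n))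
       (λ a a≢d → countᵇ-never (words k n) (λ v → cong (_∧ does (v ≟w c)) (dec-false (a Fin.≟ d) a≢d))) ⟩
    countWords n (λ v → does (v ≟w c)) + pred k * 0
  ≡⟨ trans (cong (countWords n (λ v → does (v ≟w c)) +_) (*-zeroʳ (pred k))) (+-identityʳ _) ⟩
    countWords n (λ v → does (v ≟w c))
  ≤⟨ countWords-≟≤1 n c ⟩
    1
  ∎
  where open ≤-Reasoning

countWords-≤1 : ∀ n (f : Word k → Bool) →
                (∀ {v v'} → length v ≡ n → length v' ≡ n → f v ≡ true → f v' ≡ true → v ≡ v') →
                countWords n f ≤ 1
countWords-≤1 {k} n f unique with witnessOrNone (words k n) (words-length n)
  where
  witnessOrNone : (ws : List (Word k)) → All (λ w → length w ≡ n) ws →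
                  (∃₂ λ x (_ : length x ≡ n) → f x ≡ true) ⊎ countᵇ f ws ≡ 0
  witnessOrNone [] [] = inj₂ refl
  witnessOrNone (w ∷ ws) (|w| ∷ |ws|) with f w in fw
  ... | true = inj₁ (w , |w| , fw)
  ... | false = witnessOrNone ws |ws|
... | inj₂ none = ≤-trans (≤-reflexive none) z≤n
... | inj₁ (x , |x| , fx) = ≤-trans
  (countᵇ-mono (words-length n) (λ v |v| fv → dec-true (v ≟w x) (unique |v| |x| fv fx)))
  (countWords-≟≤1 n x)

-- Factors and occurrences

take-length-++ : (xs ys : List X) → take (length xs) (xs ++ ys) ≡ xs
take-length-++ [] ys = refl
take-length-++ (x ∷ xs) ys = cong (x ∷_) (take-length-++ xs ys)

drop-length-++ : (xs ys : List X) → drop (length xs) (xs ++ ys) ≡ ys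
drop-length-++ [] ys = refl
drop-length-++ (x ∷ xs) ys = drop-length-++ xs ys

take-++ˡ : ∀ j (xs ys : List X) → j ≤ length xs → take j (xs ++ ys) ≡ take j xs
take-++ˡ zero xs ys j≤ = refl
take-++ˡ (suc j) (x ∷ xs) ys (s≤s j≤) = cong (x ∷_) (take-++ˡ j xs ys j≤)

take-length+-++ : ∀ i (xs ys : List X) → take (length xs + i) (xs ++ ys) ≡ xs ++ take i ys
take-length+-++ i [] ys = refl
take-length+-++ i (x ∷ xs) ys = cong (x ∷_) (take-length+-++ i xs ys)

length-take-≤ : ∀ j (xs : List X) → j ≤ length xs → length (take j xs) ≡ j
length-take-≤ j xs j≤ = trans (length-take j xs) (m≤n⇒m⊓n≡m j≤)

take++take-drop++drop : ∀ i j (xs : List X) → xs ≡ take i xs ++ take j (drop i xs) ++ drop (i + j) xs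
take++take-drop++drop i j xs = begin
    xs
  ≡⟨ sym (take++drop≡id i xs) ⟩
    take i xs ++ drop i xs
  ≡⟨ cong (take i xs ++_) (sym (take++drop≡id j (drop i xs))) ⟩
    take i xs ++ take j (drop i xs) ++ drop j (drop i xs)
  ≡⟨ cong (λ ys → take i xs ++ take j (drop i xs) ++ ys) (drop-drop i j xs) ⟩
    take i xs ++ take j (drop i xs) ++ drop (i + j) xs
  ∎
  where open ≡-Reasoning

Infix : Word k → Word k → Set
Infix u x = ∃₂ λ a b → x ≡ a ++ u ++ b

Factor⇒Infix : (u x : Word k) → Factor u x → Infix u x
Factor⇒Infix u x (i , u-at-i) = take (toℕ i) x , drop (length u) (drop (toℕ i) x) , (begin
    x
  ≡⟨ sym (take++drop≡id (toℕ i) x) ⟩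
    take (toℕ i) x ++ drop (toℕ i) x
  ≡⟨ cong (take (toℕ i) x ++_) (sym (take++drop≡id (length u) (drop (toℕ i) x))) ⟩
    take (toℕ i) x ++ take (length u) (drop (toℕ i) x) ++ drop (length u) (drop (toℕ i) x)
  ≡⟨ cong (λ v → take (toℕ i) x ++ v ++ drop (length u) (drop (toℕ i) x)) u-at-i ⟩
    take (toℕ i) x ++ u ++ drop (length u) (drop (toℕ i) x)
  ∎)
  where open ≡-Reasoning

Occurrence : Word k → (w : Word k) → ℕ → Set
Occurrence u w q = ∃ λ (i : Fin (suc (length w))) → toℕ i ≡ q × OccursAt u w i

occursAfter : (u p s : Word k) → Occurrence u (p ++ u ++ s) (length p)
occursAfter u p s = fromℕ< |p|< , toℕ-i , subst (λ q → take (length u) (drop q (p ++ u ++ s)) ≡ u) (sym toℕ-i)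
  (trans (cong (take (length u)) (drop-length-++ p (u ++ s))) (take-length-++ u s))
  where
  |p|< : length p < suc (length (p ++ u ++ s))
  |p|< = s≤s (length-++-≤ˡ p)
  toℕ-i : toℕ (fromℕ< |p|<) ≡ length p
  toℕ-i = Fin.toℕ-fromℕ< |p|<

Infix⇒Factor : (u x : Word k) → Infix u x → Factor u x
Infix⇒Factor u x (a , b , refl) with occursAfter u a b
... | i , _ , u-at-i = i , u-at-i

3≤occ : {u w : Word k} {q₁ q₂ q₃ : ℕ} → q₁ < q₂ → q₂ < q₃ →
        Occurrence u w q₁ → Occurrence u w q₂ → Occurrence u w q₃ → 3 ≤ occ u w
3≤occ {u = u} {w} i<j j<l (i , refl , u-at-i) (j , refl , u-at-j) (l , refl , u-at-l) =
  subst (3 ≤_) (sym (count≡countᵇ (occursAt? u w) (allFin (suc (length w)))))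
    (3≤countᵇ-allFin _ i<j j<l
      (dec-true (occursAt? u w i) u-at-i) (dec-true (occursAt? u w j) u-at-j) (dec-true (occursAt? u w l) u-at-l))

3≤occ-uaubu : (u a b : Word k) → 0 < length u → 3 ≤ occ u (u ++ a ++ u ++ b ++ u)
3≤occ-uaubu u a b 0<|u| = 3≤occ 0<|ua| |ua|<|uaub|
  (occursAfter u [] (a ++ u ++ b ++ u))
  (subst (λ w → Occurrence u w (length (u ++ a))) (++-assoc u a (u ++ b ++ u)) (occursAfter u (u ++ a) (b ++ u)))
  (subst (λ w → Occurrence u w (length (u ++ a ++ u ++ b))) uaub·u (occursAfter u (u ++ a ++ u ++ b) []))
  where
  0<|ua| : 0 < length (u ++ a)
  0<|ua| = ≤-trans 0<|u| (length-++-≤ˡ u)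
  |ua|<|uaub| : length (u ++ a) < length (u ++ a ++ u ++ b)
  |ua|<|uaub| rewrite length-++ u {a} | length-++ u {a ++ u ++ b} | length-++ a {u ++ b} =
    +-monoʳ-< (length u) (m<m+n (length a) (≤-trans 0<|u| (length-++-≤ˡ u)))
  uaub·u : (u ++ a ++ u ++ b) ++ u ++ [] ≡ u ++ a ++ u ++ b ++ u
  uaub·u = begin
      (u ++ a ++ u ++ b) ++ u ++ []
    ≡⟨ cong ((u ++ a ++ u ++ b) ++_) (++-identityʳ u) ⟩
      (u ++ a ++ u ++ b) ++ u
    ≡⟨ ++-assoc u (a ++ u ++ b) u ⟩
      u ++ (a ++ u ++ b) ++ u
    ≡⟨ cong (u ++_) (++-assoc a (u ++ b) u) ⟩
      u ++ a ++ (u ++ b) ++ u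
    ≡⟨ cong (λ v → u ++ a ++ v) (++-assoc u b u) ⟩
      u ++ a ++ u ++ b ++ u
    ∎
    where open ≡-Reasoning

-- Avoiding a word of length t versus avoiding 0^t

-- naiveAvoids u r x scans x for u, where r is the part of u still to be matched. A mismatching
-- letter is discarded rather than re-examined, so each letter either advances the match (one
-- choice) or restarts it (k − 1 choices) whatever u is.
naiveAvoids : Word k → Word k → Word k → Bool
naiveAvoids u [] x = false
naiveAvoids u (d ∷ r) [] = true
naiveAvoids u (d ∷ r) (c ∷ x) = if does (c Fin.≟ d) then naiveAvoids u r x else naiveAvoids u u x

naiveAvoids≡false⇒Infix : ∀ (u r x p : Word k) → naiveAvoids u r x ≡ false → u ≡ p ++ r → Infix u (p ++ x)
naiveAvoids≡false⇒Infix u [] x p _ u≡p = [] , x , cong (_++ x) (trans (sym (++-identityʳ p)) (sym u≡p))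
naiveAvoids≡false⇒Infix u (d ∷ r) (c ∷ x) p found u≡p++dr with c Fin.≟ d
... | yes refl with naiveAvoids≡false⇒Infix u r x (p ++ c ∷ []) found (trans u≡p++dr (sym (++-assoc p (c ∷ []) r)))
...   | a , b , eq = a , b , trans (sym (++-assoc p (c ∷ []) x)) eq
naiveAvoids≡false⇒Infix u (d ∷ r) (c ∷ x) p found _ | no _ with naiveAvoids≡false⇒Infix u u x [] found refl
...   | a , b , refl = p ++ c ∷ a , b , sym (++-assoc p (c ∷ a) (u ++ b))

countWords-naiveAvoids-∷ : ∀ m (u r : Word k) (d : Fin k) →
  countWords (suc m) (naiveAvoids u (d ∷ r)) ≡ countWords m (naiveAvoids u r) + pred k * countWords m (naiveAvoids u u)
countWords-naiveAvoids-∷ {k} m u r d = trans (countWords-suc m (naiveAvoids u (d ∷ r)))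
  (sum-allFin-except d _ (countᵇ-cong (λ v → cong (branch v) (dec-true (d Fin.≟ d) refl)) (words k m))
                         (λ a a≢d → countᵇ-cong (λ v → cong (branch v) (dec-false (a Fin.≟ d) a≢d)) (words k m)))
  where
  branch : Word k → Bool → Bool
  branch v b = if b then naiveAvoids u r v else naiveAvoids u u v

countWords-naiveAvoids : ∀ m (u u' r r' : Word k) → length u ≡ length u' → length r ≡ length r' →
                         countWords m (naiveAvoids u r) ≡ countWords m (naiveAvoids u' r')
countWords-naiveAvoids zero u u' [] [] _ _ = refl
countWords-naiveAvoids zero u u' (d ∷ r) (d' ∷ r') _ _ = refl
countWords-naiveAvoids {k} (suc m) u u' [] [] _ _ =
  trans (countᵇ-never (words k (suc m)) (λ _ → refl)) (sym (countᵇ-never (words k (suc m)) (λ _ → refl)))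
countWords-naiveAvoids {k} (suc m) u u' (d ∷ r) (d' ∷ r') |u|≡ |dr|≡ = begin
    countWords (suc m) (naiveAvoids u (d ∷ r))
  ≡⟨ countWords-naiveAvoids-∷ m u r d ⟩
    countWords m (naiveAvoids u r) + pred k * countWords m (naiveAvoids u u)
  ≡⟨ cong₂ (λ x y → x + pred k * y) (countWords-naiveAvoids m u u' r r' |u|≡ (suc-injective |dr|≡))
                                     (countWords-naiveAvoids m u u' u u' |u|≡ |u|≡) ⟩
    countWords m (naiveAvoids u' r') + pred k * countWords m (naiveAvoids u' u')
  ≡⟨ sym (countWords-naiveAvoids-∷ m u' r' d') ⟩
    countWords (suc m) (naiveAvoids u' (d' ∷ r'))
  ∎
  where open ≡-Reasoning

zeros-+ : (z : Fin k) (r s : ℕ) → zeros z (r + s) ≡ zeros z r ++ zeros z s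
zeros-+ z zero s = refl
zeros-+ z (suc r) s = cong (z ∷_) (zeros-+ z r s)

length-zeros : (z : Fin k) (t : ℕ) → length (zeros z t) ≡ t
length-zeros z zero = refl
length-zeros z (suc t) = cong suc (length-zeros z t)

naiveAvoids-zeros-++ : (z : Fin k) (u : Word k) (r : ℕ) (y : Word k) → naiveAvoids u (zeros z r) (zeros z r ++ y) ≡ false
naiveAvoids-zeros-++ z u zero y = refl
naiveAvoids-zeros-++ z u (suc r) y rewrite dec-true (z Fin.≟ z) refl = naiveAvoids-zeros-++ z u r y

naiveAvoids-zeros-infix : (z : Fin k) (t r : ℕ) (p q : Word k) → r ≤ t →
                          naiveAvoids (zeros z t) (zeros z r) (p ++ zeros z t ++ q) ≡ false
naiveAvoids-zeros-infix z t r [] q r≤t =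
  subst (λ w → naiveAvoids (zeros z t) (zeros z r) w ≡ false) zeros-split (naiveAvoids-zeros-++ z (zeros z t) r _)
  where
  zeros-split : zeros z r ++ zeros z (t ∸ r) ++ q ≡ zeros z t ++ q
  zeros-split = trans (sym (++-assoc (zeros z r) (zeros z (t ∸ r)) q))
    (cong (_++ q) (trans (sym (zeros-+ z r (t ∸ r))) (cong (zeros z) (m+[n∸m]≡n r≤t))))
naiveAvoids-zeros-infix z t zero (a ∷ p) q r≤t = refl
naiveAvoids-zeros-infix z t (suc r) (a ∷ p) q r≤t with a Fin.≟ z
... | yes _ = naiveAvoids-zeros-infix z t r p q (≤-trans (n≤1+n r) r≤t)
... | no _ = naiveAvoids-zeros-infix z t t p q ≤-refl

A≤A-zeros : (z : Fin k) (m : ℕ) (u : Word k) → A k m u ≤ A k m (zeros z (length u))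
A≤A-zeros {k} z m u = begin
    A k m u
  ≡⟨ count≡countᵇ (λ w → ¬? (factor? u w)) (words k m) ⟩
    countWords m (λ x → not (does (factor? u x)))
  ≤⟨ countᵇ-mono (words-length m) (λ x _ → avoids⇒naiveAvoids x) ⟩
    countWords m (naiveAvoids u u)
  ≡⟨ countWords-naiveAvoids m u 0ᵗ u 0ᵗ |u|≡|0ᵗ| |u|≡|0ᵗ| ⟩
    countWords m (naiveAvoids 0ᵗ 0ᵗ)
  ≤⟨ countᵇ-mono (words-length m) (λ x _ → naiveAvoids⇒avoids x) ⟩
    countWords m (λ x → not (does (factor? 0ᵗ x)))
  ≡⟨ count≡countᵇ (λ w → ¬? (factor? 0ᵗ w)) (words k m) ⟨
    A k m 0ᵗ
  ∎
  where
  open ≤-Reasoning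
  0ᵗ : Word k
  0ᵗ = zeros z (length u)
  |u|≡|0ᵗ| : length u ≡ length 0ᵗ
  |u|≡|0ᵗ| = sym (length-zeros z (length u))
  avoids⇒naiveAvoids : ∀ x → not (does (factor? u x)) ≡ true → naiveAvoids u u x ≡ true
  avoids⇒naiveAvoids x avoids with naiveAvoids u u x in scan
  ... | true = refl
  ... | false rewrite dec-true (factor? u x) (Infix⇒Factor u x (naiveAvoids≡false⇒Infix u u x [] scan refl)) = avoids
  naiveAvoids⇒avoids : ∀ x → naiveAvoids 0ᵗ 0ᵗ x ≡ true → not (does (factor? 0ᵗ x)) ≡ true
  naiveAvoids⇒avoids x scan = cong not (dec-false (factor? 0ᵗ x) λ 0ᵗ∈x → noInfix (Factor⇒Infix 0ᵗ x 0ᵗ∈x))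
    where
    noInfix : ¬ Infix 0ᵗ x
    noInfix (a , b , refl) with () ← trans (sym scan) (naiveAvoids-zeros-infix z (length u) (length u) a b ≤-refl)

-- Periodic words

periodic-extension-unique : (u : Word k) → 0 < length u → ∀ {v v'} → length v ≡ length v' →
  take (length v) (u ++ v) ≡ v → take (length v') (u ++ v') ≡ v' → v ≡ v'
periodic-extension-unique {k} u 0<|u| {v} |v|≡|v'| = <-rec Unique step (length v) refl (sym |v|≡|v'|)
  where
  Periodic : Word k → Set
  Periodic x = take (length x) (u ++ x) ≡ x
  Unique : ℕ → Set
  Unique n = ∀ {x x'} → length x ≡ n → length x' ≡ n → Periodic x → Periodic x' → x ≡ x'
  short : ∀ {n x} → length x ≡ n → n ≤ length u → Periodic x → x ≡ take n u
  short {n} {x} refl n≤|u| px = trans (sym px) (take-++ˡ n u x n≤|u|)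
  unfold : ∀ {n x} → length x ≡ n → length u ≤ n → Periodic x → x ≡ u ++ take (n ∸ length u) x
  unfold {n} {x} refl |u|≤n px = trans (sym px)
    (trans (cong (λ j → take j (u ++ x)) (sym (m+[n∸m]≡n |u|≤n))) (take-length+-++ _ u x))
  length-rest : ∀ {n x} → length x ≡ n → length (take (n ∸ length u) x) ≡ n ∸ length u
  length-rest {n} {x} refl = length-take-≤ _ x (m∸n≤m n (length u))
  rest-periodic : ∀ {n x} → length x ≡ n → length u ≤ n → Periodic x → Periodic (take (n ∸ length u) x)
  rest-periodic {n} {x} |x| |u|≤n px = subst (λ j → take j (u ++ rest) ≡ rest) (sym (length-rest |x|))
    (sym (cong (take (n ∸ length u)) (unfold |x| |u|≤n px)))
    where
    rest : Word k
    rest = take (n ∸ length u) x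
  step : ∀ n → (∀ {m} → m < n → Unique m) → Unique n
  step n rec |x| |x'| px px' with n ≤? length u
  ... | yes n≤|u| = trans (short |x| n≤|u| px) (sym (short |x'| n≤|u| px'))
  ... | no n≰|u| = trans (unfold |x| |u|≤n px)
    (trans (cong (u ++_) (rec (∸-monoʳ-< 0<|u| |u|≤n) (length-rest |x|) (length-rest |x'|)
                              (rest-periodic |x| |u|≤n px) (rest-periodic |x'| |u|≤n px')))
           (sym (unfold |x'| |u|≤n px')))
    where
    |u|≤n : length u ≤ n
    |u|≤n = <⇒≤ (≰⇒> n≰|u|)

hasPeriod : ℕ → ℕ → Word k → Bool
hasPeriod n p w = does (take (n ∸ p) w ≟w drop p w)

hasPeriod-++⇒periodic : ∀ {n p} {u v : Word k} → length u ≡ p → length v ≡ n ∸ p →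
                        hasPeriod n p (u ++ v) ≡ true → take (length v) (u ++ v) ≡ v
hasPeriod-++⇒periodic {n = n} {p} {u} {v} |u| |v| uv-periodic = begin
  take (length v) (u ++ v)  ≡⟨ cong (λ j → take j (u ++ v)) |v| ⟩
  take (n ∸ p) (u ++ v)     ≡⟨ does≡true⇒ (take (n ∸ p) (u ++ v) ≟w drop p (u ++ v)) uv-periodic ⟩
  drop p (u ++ v)           ≡⟨ subst (λ q → drop q (u ++ v) ≡ v) |u| (drop-length-++ u v) ⟩
  v                         ∎
  where open ≡-Reasoning

countWords-hasPeriod≤ : ∀ n p → 0 < p → p ≤ n → countWords n (hasPeriod {k} n p) ≤ k ^ p
countWords-hasPeriod≤ {k} n p 0<p p≤n = begin
    countWords n (hasPeriod n p)
  ≡⟨ cong (λ m → countWords m (hasPeriod n p)) (m+[n∸m]≡n p≤n) ⟨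
    countWords (p + (n ∸ p)) (hasPeriod n p)
  ≡⟨ countWords-++ p (n ∸ p) (hasPeriod n p) ⟩
    sum (map (λ u → countWords (n ∸ p) (hasPeriod n p ∘ (u ++_))) (words k p))
  ≤⟨ sum≤length* (words-length p) (λ u |u| → countWords-≤1 (n ∸ p) _ (λ |v| |v'| pv pv' →
       periodic-extension-unique u (subst (0 <_) (sym |u|) 0<p) (trans |v| (sym |v'|))
         (hasPeriod-++⇒periodic |u| |v| pv) (hasPeriod-++⇒periodic |u| |v'| pv'))) ⟩
    length (words k p) * 1
  ≡⟨ trans (*-identityʳ _) (length-words p) ⟩
    k ^ p
  ∎
  where open ≤-Reasoning

-- Words u x u in which u is not a factor of x

middle : ℕ → ℕ → Word k → Word k
middle n t w = take (n ∸ 2 * t) (drop t w)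

hasGappedBorder : ℕ → ℕ → Word k → Bool
hasGappedBorder n t w = does (take t w ≟w drop (n ∸ t) w) ∧ not (does (factor? (take t w) (middle n t w)))

hasGappedBorder-++ : ∀ {n t} (u x y : Word k) → 2 * t ≤ n → length u ≡ t → length x ≡ n ∸ 2 * t →
                     hasGappedBorder n t (u ++ x ++ y) ≡ (does (u ≟w y) ∧ not (does (factor? u x)))
hasGappedBorder-++ {n = n} u x y 2t≤n refl |x|
  rewrite take-length-++ u (x ++ y) | drop-length-++ u (x ++ y) | sym |x| | take-length-++ x y =
  cong (λ y' → does (u ≟w y') ∧ not (does (factor? u x))) (begin
    drop (n ∸ length u) (u ++ x ++ y)  ≡⟨ cong (λ q → drop q (u ++ x ++ y)) |ux| ⟨
    drop (length (u ++ x)) (u ++ x ++ y) ≡⟨ cong (drop (length (u ++ x))) (++-assoc u x y) ⟨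
    drop (length (u ++ x)) ((u ++ x) ++ y) ≡⟨ drop-length-++ (u ++ x) y ⟩
    y ∎)
  where
  open ≡-Reasoning
  |ux| : length (u ++ x) ≡ n ∸ length u
  |ux| = trans (length-++ u) (trans (cong (length u +_) |x|) (sym (n∸t≡t+[n∸2t] (length u) 2t≤n)))

countWords-≟∧≤ : ∀ t (u : Word k) (b : Bool) → countWords t (λ y → does (u ≟w y) ∧ b) ≤ iverson b
countWords-≟∧≤ {k} t u false = ≤-reflexive (countᵇ-never (words k t) (λ y → ∧-zeroʳ (does (u ≟w y))))
countWords-≟∧≤ t u true = countWords-≤1 t _ (λ _ _ uy uy' → trans (sym (u≡ uy)) (u≡ uy'))
  where
  u≡ : ∀ {y} → (does (u ≟w y) ∧ true) ≡ true → u ≡ y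
  u≡ {y} uy = does≡true⇒ (u ≟w y) (trans (sym (∧-identityʳ (does (u ≟w y)))) uy)

countWords-hasGappedBorder≤ : ∀ n t → 2 * t ≤ n → (z : Fin k) →
                              countWords n (hasGappedBorder {k} n t) ≤ k ^ t * A k (n ∸ 2 * t) (zeros z t)
countWords-hasGappedBorder≤ {k} n t 2t≤n z = begin
    countWords n (hasGappedBorder n t)
  ≡⟨ cong (λ l → countWords l (hasGappedBorder n t)) (n≡t+[[n∸2t]+t] t 2t≤n) ⟩
    countWords (t + (m + t)) (hasGappedBorder n t)
  ≡⟨ countWords-++ t (m + t) (hasGappedBorder n t) ⟩
    sum (map (λ u → countWords (m + t) (hasGappedBorder n t ∘ (u ++_))) (words k t))
  ≤⟨ sum≤length* (words-length t) perBorder ⟩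
    length (words k t) * A k m (zeros z t)
  ≡⟨ cong (_* A k m (zeros z t)) (length-words t) ⟩
    k ^ t * A k m (zeros z t)
  ∎
  where
  open ≤-Reasoning
  m : ℕ
  m = n ∸ 2 * t
  perBorder : ∀ u → length u ≡ t → countWords (m + t) (hasGappedBorder n t ∘ (u ++_)) ≤ A k m (zeros z t)
  perBorder u |u| = begin
      countWords (m + t) (hasGappedBorder n t ∘ (u ++_))
    ≡⟨ countWords-++ m t (hasGappedBorder n t ∘ (u ++_)) ⟩
      sum (map (λ x → countWords t (hasGappedBorder n t ∘ (u ++_) ∘ (x ++_))) (words k m))
    ≤⟨ sum-mono (words-length m) perMiddle ⟩
      countWords m (λ x → not (does (factor? u x)))
    ≡⟨ count≡countᵇ (λ x → ¬? (factor? u x)) (words k m) ⟨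
      A k m u
    ≤⟨ subst (λ l → A k m u ≤ A k m (zeros z l)) |u| (A≤A-zeros z m u) ⟩
      A k m (zeros z t)
    ∎
    where
    perMiddle : ∀ x → length x ≡ m →
                countWords t (hasGappedBorder n t ∘ (u ++_) ∘ (x ++_)) ≤ iverson (not (does (factor? u x)))
    perMiddle x |x| = begin
        countWords t (hasGappedBorder n t ∘ (u ++_) ∘ (x ++_))
      ≡⟨ countᵇ-cong (λ y → hasGappedBorder-++ u x y 2t≤n |u| |x|) (words k t) ⟩
        countWords t (λ y → does (u ≟w y) ∧ not (does (factor? u x)))
      ≤⟨ countWords-≟∧≤ t u (not (does (factor? u x))) ⟩
        iverson (not (does (factor? u x)))
      ∎

-- Closed words

closedCandidate : ℕ → Word k → Bool
closedCandidate n w = anyFrom1 ⌊ n /2⌋ (λ t → hasGappedBorder n t w) ∨ anyFrom1 ⌊ n /2⌋ (λ p → hasPeriod n p w)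

longBorder⇒hasPeriod : (w : Word k) {t : ℕ} → t ≤ length w → take t w ≡ drop (length w ∸ t) w →
                       hasPeriod (length w) (length w ∸ t) w ≡ true
longBorder⇒hasPeriod w {t} t≤|w| border =
  dec-true (_ ≟w _) (subst (λ q → take q w ≡ drop (length w ∸ t) w) (sym (m∸[m∸n]≡n t≤|w|)) border)

shortBorder⇒hasGappedBorder : (w : Word k) {t : ℕ} → 0 < t → 2 * t < length w →
                              take t w ≡ drop (length w ∸ t) w → occ (take t w) w ≡ 2 →
                              hasGappedBorder (length w) t w ≡ true
shortBorder⇒hasGappedBorder {k} w {t} 0<t 2t<|w| border occ≡2 =
  cong₂ _∧_ (dec-true (u ≟w _) border) (cong not (dec-false (factor? u (middle (length w) t w)) u∉middle))
  where
  u : Word k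
  u = take t w
  M : ℕ
  M = length w ∸ 2 * t
  t≤|w| : t ≤ length w
  t≤|w| = ≤-trans (m≤m+n t t) (≤-trans (≤-reflexive (sym (2*m≡m+m t))) (<⇒≤ 2t<|w|))
  0<|u| : 0 < length u
  0<|u| = subst (0 <_) (sym (length-take-≤ t w t≤|w|)) 0<t
  u∉middle : ¬ Factor u (middle (length w) t w)
  u∉middle u∈middle with Factor⇒Infix u _ u∈middle
  ... | a , b , middle≡aub =
    <⇒≱ (s≤s (s≤s (s≤s z≤n)))
        (subst (3 ≤_) occ≡2 (subst (λ x → 3 ≤ occ u x) (sym w≡uaubu) (3≤occ-uaubu u a b 0<|u|)))
    where
    w≡uaubu : w ≡ u ++ a ++ u ++ b ++ u
    w≡uaubu = begin
      w                                             ≡⟨ take++take-drop++drop t M w ⟩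
      u ++ middle (length w) t w ++ drop (t + M) w  ≡⟨ cong₂ (λ x y → u ++ x ++ y) middle≡aub suffix≡u ⟩
      u ++ (a ++ u ++ b) ++ u                       ≡⟨ cong (u ++_) (++-assoc a (u ++ b) u) ⟩
      u ++ a ++ (u ++ b) ++ u                       ≡⟨ cong (λ v → u ++ a ++ v) (++-assoc u b u) ⟩
      u ++ a ++ u ++ b ++ u                         ∎
      where
      open ≡-Reasoning
      suffix≡u : drop (t + M) w ≡ u
      suffix≡u = trans (cong (λ q → drop q w) (sym (n∸t≡t+[n∸2t] t (<⇒≤ 2t<|w|)))) (sym border)

closed⇒closedCandidate : (w : Word k) → 2 ≤ length w → Closed w → closedCandidate (length w) w ≡ true
closed⇒closedCandidate w 2≤|w| (inj₁ |w|≤1) = ⊥-elim (<⇒≱ 2≤|w| |w|≤1)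
closed⇒closedCandidate w _ (inj₂ (j , (0<t , border) , occ≡2)) with length w ≤? 2 * toℕ j
... | yes |w|≤2t = trans (cong (anyFrom1 ⌊ N /2⌋ (λ t → hasGappedBorder N t w) ∨_)
                         (anyFrom1-intro ⌊ N /2⌋ (λ p → hasPeriod N p w) (m<n⇒0<n∸m t<N) p≤⌊N/2⌋
                           (longBorder⇒hasPeriod w (<⇒≤ t<N) border)))
                         (∨-zeroʳ _)
  where
  N : ℕ
  N = length w
  t : ℕ
  t = toℕ j
  t<N : t < N
  t<N = Fin.toℕ<n j
  N∸t≤t : N ∸ t ≤ t
  N∸t≤t = ≤-trans (∸-monoˡ-≤ t |w|≤2t) (≤-reflexive (trans (cong (_∸ t) (2*m≡m+m t)) (m+n∸m≡n t t)))
  p≤⌊N/2⌋ : N ∸ t ≤ ⌊ N /2⌋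
  p≤⌊N/2⌋ = m+m≤n⇒m≤⌊n/2⌋ (≤-trans (+-monoʳ-≤ (N ∸ t) N∸t≤t) (≤-reflexive (m∸n+n≡m (<⇒≤ t<N))))
... | no |w|≰2t = cong (_∨ anyFrom1 ⌊ N /2⌋ (λ p → hasPeriod N p w))
                    (anyFrom1-intro ⌊ N /2⌋ (λ t → hasGappedBorder N t w) 0<t
                      (m+m≤n⇒m≤⌊n/2⌋ (subst (_≤ N) (2*m≡m+m (toℕ j)) (<⇒≤ (≰⇒> |w|≰2t))))
                      (shortBorder⇒hasGappedBorder w 0<t (≰⇒> |w|≰2t) border occ≡2))
  where
  N : ℕ
  N = length w

C≤gappedBorders+periods : ∀ n → 2 ≤ n →
  C k n ≤ sumFrom1 ⌊ n /2⌋ (λ t → countWords n (hasGappedBorder {k} n t))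
        + sumFrom1 ⌊ n /2⌋ (λ p → countWords n (hasPeriod {k} n p))
C≤gappedBorders+periods {k} n 2≤n = begin
    C k n
  ≡⟨ count≡countᵇ closed? (words k n) ⟩
    countWords n (does ∘ closed?)
  ≤⟨ countᵇ-mono (words-length n) (λ w |w| w-closed →
       subst (λ l → closedCandidate l w ≡ true) |w|
         (closed⇒closedCandidate w (subst (2 ≤_) (sym |w|) 2≤n) (does≡true⇒ (closed? w) w-closed))) ⟩
    countWords n (closedCandidate n)
  ≤⟨ ≤-trans (countᵇ-∨ _ _ (words k n))
       (+-mono-≤ (countᵇ-anyFrom1 ⌊ n /2⌋ (hasGappedBorder n) (words k n))
                 (countᵇ-anyFrom1 ⌊ n /2⌋ (hasPeriod n) (words k n))) ⟩
    sumFrom1 ⌊ n /2⌋ (λ t → countWords n (hasGappedBorder n t)) + sumFrom1 ⌊ n /2⌋ (λ p → countWords n (hasPeriod n p))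
  ∎
  where open ≤-Reasoning

sumFrom1-countWords-hasPeriod≤ : ∀ n → 0 < k →
  sumFrom1 ⌊ n /2⌋ (λ p → countWords n (hasPeriod {k} n p)) ≤ ⌊ n /2⌋ * k ^ ⌈ n /2⌉
sumFrom1-countWords-hasPeriod≤ {k} n 0<k = sumFrom1≤* ⌊ n /2⌋ (λ p 0<p p≤⌊n/2⌋ → ≤-trans
  (countWords-hasPeriod≤ n p 0<p (≤-trans p≤⌊n/2⌋ (⌊n/2⌋≤n n)))
  (^-monoʳ-≤ k {{>-nonZero 0<k}} (≤-trans p≤⌊n/2⌋ (⌊n/2⌋≤⌈n/2⌉ n))))

C≤k^n : ∀ n → C k n ≤ k ^ n
C≤k^n {k} n = ≤-trans (≤-reflexive (count≡countᵇ closed? (words k n)))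
  (≤-trans (countᵇ≤length _ (words k n)) (≤-reflexive (length-words n)))

corollary9 : (n k : ℕ) → 1 ≤ n → (k≥2 : 2 ≤ k) →
    C k n ≤ sumFrom1 ⌊ n /2⌋ (λ t → k ^ t * A k (n ∸ 2 * t) (zeros (letter0 (≤-trans (n≤1+n 1) k≥2)) t))
            + n * k ^ ⌈ n /2⌉
corollary9 1 k _ _ = ≤-trans (C≤k^n {k} 1) (≤-reflexive (sym (+-identityʳ _)))
corollary9 n@(suc (suc _)) k _ k≥2 = begin
    C k n
  ≤⟨ C≤gappedBorders+periods {k} n (s≤s (s≤s z≤n)) ⟩
    gappedBorders + periods
  ≤⟨ +-mono-≤ (sumFrom1-mono ⌊ n /2⌋ λ t _ t≤⌊n/2⌋ → countWords-hasGappedBorder≤ n t (m≤⌊n/2⌋⇒2*m≤n n t≤⌊n/2⌋) z)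
              (sumFrom1-countWords-hasPeriod≤ n (≤-trans (s≤s z≤n) k≥2)) ⟩
    avoidanceSum + ⌊ n /2⌋ * k ^ ⌈ n /2⌉
  ≤⟨ +-monoʳ-≤ avoidanceSum (*-monoˡ-≤ (k ^ ⌈ n /2⌉) (⌊n/2⌋≤n n)) ⟩
    avoidanceSum + n * k ^ ⌈ n /2⌉
  ∎
  where
  open ≤-Reasoning
  z : Fin k
  z = letter0 (≤-trans (n≤1+n 1) k≥2)
  gappedBorders periods avoidanceSum : ℕ
  gappedBorders = sumFrom1 ⌊ n /2⌋ (λ t → countWords n (hasGappedBorder {k} n t))
  periods = sumFrom1 ⌊ n /2⌋ (λ p → countWords n (hasPeriod {k} n p))
  avoidanceSum = sumFrom1 ⌊ n /2⌋ (λ t → k ^ t * A k (n ∸ 2 * t) (zeros z t))
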